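{- Let $H$ be a finite simple graph that is not realizable. Then there exists at least one realizable graph $H'$ such that $H$ is an induced subgraph of $H'$.
   Context: A directed multigraph has a finite vertex set and a finite multiset of arcs (loops and multiple arcs allowed). A simple cycle is a closed sequence of arcs $(i_0,i_1)_{k_1}\cdots(i_{\ell-1},i_0)_{k_\ell}$, $\ell\ge1$, with all $i_t$ distinct, considered up to cyclic rotation (orientation and the specific arcs used matter; a self-loop is a simple cycle of length one). The hike dependency graph $\phi(G)$ is the simple graph whose vertices are the simple cycles of $G$, two distinct simple cycles being adjacent iff they share a vertex of $G$. A finite simple graph $H$ is realizable if $H\cong\phi(G)$ for some directed multigraph $G$. -}

module Defs where

open import Data.Nat using (ℕ)
open import Data.Fin using (Fin)
open import Data.Empty using (⊥)
open import Data.Bool using (Bool; true; false)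
open import Data.List using (List; []; _∷_; map; _++_)
open import Data.List.Membership.Propositional using (_∈_)
open import Data.List.Relation.Unary.Unique.Propositional using (Unique)
open import Data.Product using (Σ; ∃; ∃-syntax; _×_; _,_)
open import Relation.Nullary using (¬_)
open import Relation.Binary.PropositionalEquality using (_≡_)
open import Function.Bundles using (_⇔_)

record SimpleGraph : Set where
  field
    n      : ℕ
    adj    : Fin n → Fin n → Bool
    sym    : ∀ i j → adj i j ≡ adj j i
    irrefl : ∀ i → adj i i ≡ false
open SimpleGraph public

-- Directed multigraphs: vertex set Fin V, arcs indexed by Fin A
-- (so parallel arcs and loops are allowed), each arc with a source
-- and a target.

record DiMultigraph : Set where
  field
    V   : ℕ
    A   : ℕ
    src : Fin A → Fin V
    tgt : Fin A → Fin V
open DiMultigraph public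

module _ (G : DiMultigraph) where

  Path : Fin (A G) → List (Fin (A G)) → Fin (V G) → Set
  Path a []       v = tgt G a ≡ v
  Path a (b ∷ bs) v = (tgt G a ≡ src G b) × Path b bs v

  cycleVertices : List (Fin (A G)) → List (Fin (V G))
  cycleVertices c = map (src G) c

  -- A simple cycle, represented by a (nonempty) list of arcs
  -- (i_0,i_1)_{k_1} ... (i_{ℓ-1},i_0)_{k_ℓ}, closed, with all i_t distinct.
  IsSimpleCycle : List (Fin (A G)) → Set
  IsSimpleCycle []       = ⊥
  IsSimpleCycle (a ∷ bs) = Path a bs (src G a) × Unique (cycleVertices (a ∷ bs))

  -- Cyclic rotation of arc sequences (simple cycles are considered up to it).
  Rotation : List (Fin (A G)) → List (Fin (A G)) → Set
  Rotation c d = ∃[ xs ] ∃[ ys ] (c ≡ xs ++ ys) × (d ≡ ys ++ xs)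

  ShareVertex : List (Fin (A G)) → List (Fin (A G)) → Set
  ShareVertex c d = ∃[ v ] (v ∈ cycleVertices c) × (v ∈ cycleVertices d)

-- H ≅ φ(G): a bijection f from the vertices of H onto the simple cycles of G
-- modulo rotation (each f i a simple cycle, every simple cycle is a rotation
-- of some f i, and distinct i give non-rotation-equivalent cycles) such that
-- i ~ j in H iff f i, f j are distinct simple cycles sharing a vertex of G.
IsoToHikeGraph : SimpleGraph → DiMultigraph → Set
IsoToHikeGraph H G =
  Σ (Fin (n H) → List (Fin (A G))) λ f →
      (∀ i → IsSimpleCycle G (f i))
    × (∀ c → IsSimpleCycle G c → ∃[ i ] Rotation G c (f i))
    × (∀ i j → Rotation G (f i) (f j) → i ≡ j)
    × (∀ i j → (adj H i j ≡ true) ⇔ ((¬ Rotation G (f i) (f j)) × ShareVertex G (f i) (f j)))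

Realizable : SimpleGraph → Set
Realizable H = ∃[ G ] IsoToHikeGraph H G

InducedSubgraph : SimpleGraph → SimpleGraph → Set
InducedSubgraph H H' =
  Σ (Fin (n H) → Fin (n H')) λ g →
      (∀ i j → g i ≡ g j → i ≡ j)
    × (∀ i j → adj H i j ≡ adj H' (g i) (g j))

-- Every finite simple graph H is an induced subgraph of a realizable graph,
-- namely of φ(G_H) for the following multigraph G_H.  Give every vertex i of H
-- a directed cycle C_i with one stop for each vertex j of H: the stop is the
-- ordered pair (i , j) if i and j are not adjacent, and the unordered pair
-- {i , j} if they are.  Then C_i and C_j share a vertex exactly when i ~ j,
-- and the stop (i , i) belongs to C_i alone, so i ↦ C_i embeds H into φ(G_H)
-- as an induced subgraph.  That φ(G) is a finite simple graph for every G
-- follows by enumerating the simple cycles, which have length at most |V(G)|,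
-- and keeping one representative per rotation class.

module Submission where

open import Defs hiding (sym)
open import Data.Bool using (true; false; if_then_else_)
open import Data.Bool.Properties using (⇔→≡)
open import Data.Empty using (⊥-elim)
open import Data.Fin using (Fin; zero; suc; inject₁; fromℕ; combine; remQuot)
open import Data.Fin.Properties
  using (_≟_; _≤?_; ≤-antisym; ≤-total; combine-injective; remQuot-combine; injective⇒≤)
open import Data.List using (List; []; _∷_; _++_; length; lookup; tabulate; filter; allFin; cartesianProductWith)
open import Data.List.Properties
  using (∷-injectiveˡ; ∷-injectiveʳ; ++-identityʳ; ≡-dec; length-map; map-tabulate; tabulate-cong)
open import Data.List.Membership.Propositional using (_∈_; find; lose)
open import Data.List.Membership.Propositional.Properties
  using (∈-lookup; ∈-allFin; ∈-filter⁺; ∈-filter⁻; ∈-cartesianProductWith⁺; ∈-tabulate⁺; ∈-tabulate⁻)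
import Data.List.Membership.DecPropositional as DecMembership
open import Data.List.Relation.Unary.Any as Any using (Any; here; there; any?)
open import Data.List.Relation.Unary.Any.Properties using (map⁺; map⁻; ++-comm; lookup-index)
import Data.List.Relation.Unary.All as All
open import Data.List.Relation.Unary.All.Properties using (¬Any⇒All¬)
open import Data.List.Relation.Unary.AllPairs using (AllPairs; []; _∷_)
open import Data.List.Relation.Unary.Unique.Propositional using (Unique)
open import Data.List.Relation.Unary.Unique.Propositional.Properties using (tabulate⁺)
open import Data.List.Relation.Unary.Unique.DecPropositional using (unique?)
open import Data.Nat using (ℕ; zero; suc; _*_; _≤_; s≤s)
open import Data.Product using (∃-syntax; _×_; _,_; proj₁; proj₂; uncurry; swap)
open import Data.Sum using (_⊎_; inj₁; inj₂; [_,_]′)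
open import Function using (_∘_; Injective)
open import Function.Bundles using (_⇔_; mk⇔; Equivalence)
open import Relation.Binary using (Symmetric; Decidable)
open import Relation.Binary.PropositionalEquality
open import Relation.Nullary using (¬_; Dec; yes; no; does; contradiction)
open import Relation.Nullary.Decidable using (map′; _×-dec_; _⊎-dec_; ¬?; does-⇔; dec-false)

private
  variable
    X : Set

lookup-injective-modulo : {R : X → X → Set} → Symmetric R → {xs : List X} →
  AllPairs (λ x y → ¬ R x y) xs → ∀ {i j} → R (lookup xs i) (lookup xs j) → i ≡ j
lookup-injective-modulo R-sym (_  ∷ _ ) {zero}  {zero}  _ = refl
lookup-injective-modulo R-sym (¬R ∷ _ ) {zero}  {suc j} r = contradiction r (All.lookup ¬R (∈-lookup j))
lookup-injective-modulo R-sym (¬R ∷ _ ) {suc i} {zero}  r = contradiction (R-sym r) (All.lookup ¬R (∈-lookup i))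
lookup-injective-modulo R-sym (_  ∷ ps) {suc i} {suc j} r = cong suc (lookup-injective-modulo R-sym ps r)

length-Unique-≤ : ∀ {m} {xs : List (Fin m)} → Unique xs → length xs ≤ m
length-Unique-≤ u = injective⇒≤ (lookup-injective-modulo sym u)

listsOfLength≤ : List X → ℕ → List (List X)
listsOfLength≤ xs zero    = [] ∷ []
listsOfLength≤ xs (suc k) = [] ∷ cartesianProductWith _∷_ xs (listsOfLength≤ xs k)

∈-listsOfLength≤ : {xs : List X} → (∀ x → x ∈ xs) →
  ∀ k {ys : List X} → length ys ≤ k → ys ∈ listsOfLength≤ xs k
∈-listsOfLength≤ all zero    {[]}     _         = here refl
∈-listsOfLength≤ all (suc k) {[]}     _         = here refl
∈-listsOfLength≤ all (suc k) {y ∷ ys} (s≤s ys≤k) =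
  there (∈-cartesianProductWith⁺ _∷_ (all y) (∈-listsOfLength≤ all k ys≤k))

∃-++? : {P : List X → List X → Set} → (∀ xs ys → Dec (P xs ys)) →
  ∀ zs → Dec (∃[ xs ] ∃[ ys ] (zs ≡ xs ++ ys) × P xs ys)
∃-++? {P = P} P? [] = map′ (λ p → [] , [] , refl , p) from (P? [] [])
  where
  from : ∃[ xs ] ∃[ ys ] ([] ≡ xs ++ ys) × P xs ys → P [] []
  from ([] , _ , refl , p) = p
∃-++? {P = P} P? (z ∷ zs) = map′ to from (P? [] (z ∷ zs) ⊎-dec ∃-++? (λ xs → P? (z ∷ xs)) zs)
  where
  to : P [] (z ∷ zs) ⊎ (∃[ xs ] ∃[ ys ] (zs ≡ xs ++ ys) × P (z ∷ xs) ys) →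
       ∃[ xs ] ∃[ ys ] (z ∷ zs ≡ xs ++ ys) × P xs ys
  to (inj₁ p)                  = [] , z ∷ zs , refl , p
  to (inj₂ (xs , ys , eq , p)) = z ∷ xs , ys , cong (z ∷_) eq , p
  from : ∃[ xs ] ∃[ ys ] (z ∷ zs ≡ xs ++ ys) × P xs ys →
         P [] (z ∷ zs) ⊎ (∃[ xs ] ∃[ ys ] (zs ≡ xs ++ ys) × P (z ∷ xs) ys)
  from ([]     , _  , refl , p) = inj₁ p
  from (x ∷ xs , ys , eq   , p) with refl ← ∷-injectiveˡ eq = inj₂ (xs , ys , ∷-injectiveʳ eq , p)

-- Unlike Data.List.Base.deduplicate, an element is dropped only when it is
-- related to a *kept* element, so covering needs no transitivity of R.
module _ {R : X → X → Set} (R? : Decidable R) where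

  representatives : List X → List X
  representatives []       = []
  representatives (x ∷ xs) with any? (R? x) (representatives xs)
  ... | yes _ = representatives xs
  ... | no  _ = x ∷ representatives xs

  representatives-⊆ : ∀ xs {y} → y ∈ representatives xs → y ∈ xs
  representatives-⊆ (x ∷ xs) y∈ with any? (R? x) (representatives xs)
  representatives-⊆ (x ∷ xs) y∈          | yes _ = there (representatives-⊆ xs y∈)
  representatives-⊆ (x ∷ xs) (here y≡x)  | no  _ = here y≡x
  representatives-⊆ (x ∷ xs) (there y∈)  | no  _ = there (representatives-⊆ xs y∈)

  representatives-cover : (∀ x → R x x) → ∀ xs {y} → y ∈ xs → Any (R y) (representatives xs)
  representatives-cover R-refl (x ∷ xs) y∈ with any? (R? x) (representatives xs)
  representatives-cover R-refl (x ∷ xs) (here refl) | yes x~ = x~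
  representatives-cover R-refl (x ∷ xs) (there y∈) | yes _  = representatives-cover R-refl xs y∈
  representatives-cover R-refl (x ∷ xs) (here refl) | no  _  = here (R-refl x)
  representatives-cover R-refl (x ∷ xs) (there y∈) | no  _  = there (representatives-cover R-refl xs y∈)

  representatives-unrelated : ∀ xs → AllPairs (λ x y → ¬ R x y) (representatives xs)
  representatives-unrelated []       = []
  representatives-unrelated (x ∷ xs) with any? (R? x) (representatives xs)
  ... | yes _  = representatives-unrelated xs
  ... | no ¬x~ = ¬Any⇒All¬ (representatives xs) ¬x~ ∷ representatives-unrelated xs

module Cycles (G : DiMultigraph) where

  rotation-refl : ∀ c → Rotation G c c
  rotation-refl c = [] , c , refl , sym (++-identityʳ c)

  rotation-sym : ∀ {c d} → Rotation G c d → Rotation G d c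
  rotation-sym (xs , ys , c≡ , d≡) = ys , xs , d≡ , c≡

  rotation? : ∀ c d → Dec (Rotation G c d)
  rotation? c d = ∃-++? (λ xs ys → ≡-dec _≟_ d (ys ++ xs)) c

  ∈-rotation : ∀ {c d v} → Rotation G c d → v ∈ cycleVertices G c → v ∈ cycleVertices G d
  ∈-rotation (xs , ys , refl , refl) = map⁺ ∘ ++-comm xs ys ∘ map⁻

  shareVertex-rotation : ∀ {c c′ d d′} → Rotation G c c′ → Rotation G d d′ →
    ShareVertex G c d → ShareVertex G c′ d′
  shareVertex-rotation r s (v , v∈c , v∈d) = v , ∈-rotation r v∈c , ∈-rotation s v∈d

  shareVertex? : ∀ c d → Dec (ShareVertex G c d)
  shareVertex? c d = map′ find (λ (v , v∈c , v∈d) → lose v∈c v∈d)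
    (any? (λ v → DecMembership._∈?_ _≟_ v (cycleVertices G d)) (cycleVertices G c))

  path? : ∀ a bs v → Dec (Path G a bs v)
  path? a []       v = tgt G a ≟ v
  path? a (b ∷ bs) v = (tgt G a ≟ src G b) ×-dec path? b bs v

  isSimpleCycle? : ∀ c → Dec (IsSimpleCycle G c)
  isSimpleCycle? []       = no λ ()
  isSimpleCycle? (a ∷ bs) = path? a bs (src G a) ×-dec unique? _≟_ (cycleVertices G (a ∷ bs))

  length-simpleCycle : ∀ c → IsSimpleCycle G c → length c ≤ V G
  length-simpleCycle (a ∷ bs) (_ , u) =
    subst (_≤ V G) (length-map (src G) (a ∷ bs)) (length-Unique-≤ u)

-- The hike dependency graph

does≡true⇔ : {P : Set} (P? : Dec P) → (does P? ≡ true) ⇔ P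
does≡true⇔ (yes p) = mk⇔ (λ _ → p) (λ _ → refl)
does≡true⇔ (no ¬p) = mk⇔ (λ ()) (λ p → contradiction p ¬p)

module HikeGraph (G : DiMultigraph) where

  open Cycles G

  HikeAdjacent : List (Fin (A G)) → List (Fin (A G)) → Set
  HikeAdjacent c d = (¬ Rotation G c d) × ShareVertex G c d

  hikeAdjacent? : ∀ c d → Dec (HikeAdjacent c d)
  hikeAdjacent? c d = ¬? (rotation? c d) ×-dec shareVertex? c d

  hikeAdjacent-sym : ∀ {c d} → HikeAdjacent c d → HikeAdjacent d c
  hikeAdjacent-sym (¬r , v , v∈c , v∈d) = ¬r ∘ rotation-sym , v , v∈d , v∈c

  candidates : List (List (Fin (A G)))
  candidates = filter isSimpleCycle? (listsOfLength≤ (allFin (A G)) (V G))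

  simpleCycles : List (List (Fin (A G)))
  simpleCycles = representatives rotation? candidates

  cycle : Fin (length simpleCycles) → List (Fin (A G))
  cycle = lookup simpleCycles

  hikeGraph : SimpleGraph
  hikeGraph = record
    { n      = length simpleCycles
    ; adj    = λ i j → does (hikeAdjacent? (cycle i) (cycle j))
    ; sym    = λ i j → does-⇔ (mk⇔ hikeAdjacent-sym hikeAdjacent-sym)
                         (hikeAdjacent? (cycle i) (cycle j)) (hikeAdjacent? (cycle j) (cycle i))
    ; irrefl = λ i → dec-false (hikeAdjacent? (cycle i) (cycle i)) (λ (¬r , _) → ¬r (rotation-refl _))
    }

  cycle-simple : ∀ i → IsSimpleCycle G (cycle i)
  cycle-simple i = proj₂ (∈-filter⁻ isSimpleCycle? {xs = listsOfLength≤ (allFin (A G)) (V G)}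
                                      (representatives-⊆ rotation? candidates (∈-lookup i)))

  cycle-cover : ∀ c → IsSimpleCycle G c → ∃[ i ] Rotation G c (cycle i)
  cycle-cover c c-simple = Any.index c~ , lookup-index c~
    where
    c∈ : c ∈ candidates
    c∈ = ∈-filter⁺ isSimpleCycle?
           (∈-listsOfLength≤ ∈-allFin (V G) (length-simpleCycle c c-simple)) c-simple
    c~ : Any (Rotation G c) simpleCycles
    c~ = representatives-cover rotation? rotation-refl candidates c∈

  cycle-distinct : ∀ i j → Rotation G (cycle i) (cycle j) → i ≡ j
  cycle-distinct i j =
    lookup-injective-modulo rotation-sym (representatives-unrelated rotation? candidates)

  hikeGraph-iso : IsoToHikeGraph hikeGraph G
  hikeGraph-iso = cycle , cycle-simple , cycle-cover , cycle-distinct ,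
                  λ i j → does≡true⇔ (hikeAdjacent? (cycle i) (cycle j))

open HikeGraph using (hikeGraph; hikeGraph-iso)

-- Graphs modelled by cycles with private vertices

record CycleModel (H : SimpleGraph) (G : DiMultigraph) : Set where
  field
    cycle          : Fin (n H) → List (Fin (A G))
    cycle-simple   : ∀ i → IsSimpleCycle G (cycle i)
    privateVertex  : Fin (n H) → Fin (V G)
    private∈       : ∀ i → privateVertex i ∈ cycleVertices G (cycle i)
    private-unique : ∀ {i j} → privateVertex i ∈ cycleVertices G (cycle j) → i ≡ j
    share⇔adj      : ∀ {i j} → i ≢ j → ShareVertex G (cycle i) (cycle j) ⇔ (adj H i j ≡ true)

inducedSubgraph-hikeGraph : ∀ {H G} H′ → CycleModel H G → IsoToHikeGraph H′ G → InducedSubgraph H H′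
inducedSubgraph-hikeGraph {H} {G} H′ M (f , _ , cover , distinct , adj⇔) = g , g-injective , g-adj
  where
  open CycleModel M
  open Cycles G
  open Equivalence

  g : Fin (n H) → Fin (n H′)
  g i = proj₁ (cover (cycle i) (cycle-simple i))

  cycle~f∘g : ∀ i → Rotation G (cycle i) (f (g i))
  cycle~f∘g i = proj₂ (cover (cycle i) (cycle-simple i))

  g-injective : ∀ i j → g i ≡ g j → i ≡ j
  g-injective i j gi≡gj = private-unique
    (∈-rotation (rotation-sym (cycle~f∘g j))
      (subst (λ k → privateVertex i ∈ cycleVertices G (f k)) gi≡gj
        (∈-rotation (cycle~f∘g i) (private∈ i))))

  adjacent⇔ : ∀ {i j} → i ≢ j → (adj H i j ≡ true) ⇔ (adj H′ (g i) (g j) ≡ true)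
  adjacent⇔ {i} {j} i≢j = mk⇔
    (λ i~j → from (adj⇔ (g i) (g j))
      ( (λ r → i≢j (g-injective i j (distinct (g i) (g j) r)))
      , shareVertex-rotation (cycle~f∘g i) (cycle~f∘g j) (from (share⇔adj i≢j) i~j)))
    (λ gi~gj → to (share⇔adj i≢j)
      (shareVertex-rotation (rotation-sym (cycle~f∘g i)) (rotation-sym (cycle~f∘g j))
        (proj₂ (to (adj⇔ (g i) (g j)) gi~gj))))

  g-adj : ∀ i j → adj H i j ≡ adj H′ (g i) (g j)
  g-adj i j with i ≟ j
  ... | yes refl = trans (irrefl H i) (sym (irrefl H′ (g i)))
  ... | no i≢j   = ⇔→≡ (adjacent⇔ i≢j)

cyclicSuc : ∀ {N} → Fin N → Fin N
cyclicSuc {suc zero}    zero    = zero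
cyclicSuc {suc (suc m)} zero    = suc zero
cyclicSuc {suc (suc m)} (suc j) with cyclicSuc j
... | zero  = zero
... | suc k = suc (suc k)

cyclicSuc-inject₁ : ∀ {m} (j : Fin m) → cyclicSuc (inject₁ j) ≡ suc j
cyclicSuc-inject₁ {suc m} zero    = refl
cyclicSuc-inject₁ {suc m} (suc j) rewrite cyclicSuc-inject₁ j = refl

cyclicSuc-fromℕ : ∀ m → cyclicSuc (fromℕ m) ≡ zero
cyclicSuc-fromℕ zero    = refl
cyclicSuc-fromℕ (suc m) rewrite cyclicSuc-fromℕ m = refl

module TabulatedCycles (G : DiMultigraph) where

  tabulate-path : ∀ {m} (h : Fin (suc m) → Fin (A G)) {v} →
    (∀ j → tgt G (h (inject₁ j)) ≡ src G (h (suc j))) → tgt G (h (fromℕ m)) ≡ v →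
    Path G (h zero) (tabulate (h ∘ suc)) v
  tabulate-path {zero}  h link last = last
  tabulate-path {suc m} h link last = link zero , tabulate-path (h ∘ suc) (link ∘ suc) last

  -- The argument of type Fin N only rules out N = 0: the empty list is no cycle.
  tabulate-isSimpleCycle : ∀ {N} → Fin N → (h : Fin N → Fin (A G)) →
    (∀ j → tgt G (h j) ≡ src G (h (cyclicSuc j))) → Injective _≡_ _≡_ (src G ∘ h) →
    IsSimpleCycle G (tabulate h)
  tabulate-isSimpleCycle {suc m} _ h link src∘h-injective =
    tabulate-path h
      (λ j → trans (link (inject₁ j)) (cong (src G ∘ h) (cyclicSuc-inject₁ j)))
      (trans (link (fromℕ m)) (cong (src G ∘ h) (cyclicSuc-fromℕ m))) ,
    subst Unique (sym (map-tabulate h (src G))) (tabulate⁺ src∘h-injective)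

-- The cycle model of a simple graph

sortPair : ∀ {N} → Fin N → Fin N → Fin N × Fin N
sortPair i j with i ≤? j
... | yes _ = i , j
... | no  _ = j , i

sortPair-comm : ∀ {N} (i j : Fin N) → sortPair i j ≡ sortPair j i
sortPair-comm i j with i ≤? j | j ≤? i
... | yes i≤j | yes j≤i = cong₂ _,_ (≤-antisym i≤j j≤i) (≤-antisym j≤i i≤j)
... | yes _   | no  _   = refl
... | no  _   | yes _   = refl
... | no  i≰j | no  j≰i = ⊥-elim ([ i≰j , j≰i ]′ (≤-total i j))

sortPair-cases : ∀ {N} (i j : Fin N) → sortPair i j ≡ (i , j) ⊎ sortPair i j ≡ (j , i)
sortPair-cases i j with i ≤? j
... | yes _ = inj₁ refl
... | no  _ = inj₂ refl

SamePair : ∀ {N} → Fin N → Fin N → Fin N → Fin N → Set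
SamePair i j k l = (i ≡ k × j ≡ l) ⊎ (i ≡ l × j ≡ k)

module CycleGraph (H : SimpleGraph) where

  N : ℕ
  N = n H

  stop : Fin N → Fin N → Fin (N * N)
  stop i j = uncurry combine (if adj H i j then sortPair i j else (i , j))

  stop-cases : ∀ i j → stop i j ≡ combine i j ⊎ stop i j ≡ combine j i
  stop-cases i j with adj H i j
  ... | false = inj₁ refl
  ... | true  with sortPair-cases i j
  ...   | inj₁ eq = inj₁ (cong (uncurry combine) eq)
  ...   | inj₂ eq = inj₂ (cong (uncurry combine) eq)

  stop-pair : ∀ {i j k l} → stop i j ≡ stop k l → SamePair i j k l
  stop-pair {i} {j} {k} {l} eq with stop-cases i j | stop-cases k l
  ... | inj₁ p | inj₁ q = inj₁ (combine-injective i j k l (trans (sym p) (trans eq q)))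
  ... | inj₁ p | inj₂ q = inj₂ (combine-injective i j l k (trans (sym p) (trans eq q)))
  ... | inj₂ p | inj₁ q = inj₂ (swap (combine-injective j i k l (trans (sym p) (trans eq q))))
  ... | inj₂ p | inj₂ q = inj₁ (swap (combine-injective j i l k (trans (sym p) (trans eq q))))

  stop-injective : ∀ {i j k} → stop i j ≡ stop i k → j ≡ k
  stop-injective eq with stop-pair eq
  ... | inj₁ (_ , j≡k)   = j≡k
  ... | inj₂ (i≡k , j≡i) = trans j≡i i≡k

  stop-adjacent : ∀ {i j} → adj H i j ≡ true → stop i j ≡ stop j i
  stop-adjacent {i} {j} i~j rewrite i~j | trans (SimpleGraph.sym H j i) i~j =
    cong (uncurry combine) (sortPair-comm i j)

  stop-symmetric⇒adjacent : ∀ {i j} → i ≢ j → stop i j ≡ stop j i → adj H i j ≡ true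
  stop-symmetric⇒adjacent {i} {j} i≢j eq with adj H i j in i~j
  ... | true  = refl
  ... | false rewrite trans (SimpleGraph.sym H j i) i~j =
    contradiction (proj₁ (combine-injective i j j i eq)) i≢j

  G : DiMultigraph
  G = record
    { V   = N * N
    ; A   = N * N
    ; src = uncurry stop ∘ remQuot N
    ; tgt = uncurry (λ i j → stop i (cyclicSuc j)) ∘ remQuot N
    }

  cycle : Fin N → List (Fin (N * N))
  cycle i = tabulate (combine i)

  src-combine : ∀ i j → src G (combine i j) ≡ stop i j
  src-combine i j = cong (uncurry stop) (remQuot-combine i j)

  tgt-combine : ∀ i j → tgt G (combine i j) ≡ stop i (cyclicSuc j)
  tgt-combine i j = cong (uncurry (λ i j → stop i (cyclicSuc j))) (remQuot-combine i j)

  cycleVertices-cycle : ∀ i → cycleVertices G (cycle i) ≡ tabulate (stop i)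
  cycleVertices-cycle i = trans (map-tabulate (combine i) (src G)) (tabulate-cong (src-combine i))

  stop∈ : ∀ i j → stop i j ∈ cycleVertices G (cycle i)
  stop∈ i j = subst (stop i j ∈_) (sym (cycleVertices-cycle i)) (∈-tabulate⁺ j)

  ∈-cycle⁻ : ∀ {i v} → v ∈ cycleVertices G (cycle i) → ∃[ j ] v ≡ stop i j
  ∈-cycle⁻ {i} v∈ = ∈-tabulate⁻ (subst (_ ∈_) (cycleVertices-cycle i) v∈)

  cycle-simple : ∀ i → IsSimpleCycle G (cycle i)
  cycle-simple i = TabulatedCycles.tabulate-isSimpleCycle G i (combine i)
    (λ j → trans (tgt-combine i j) (sym (src-combine i (cyclicSuc j))))
    (λ {j} {k} eq → stop-injective (trans (sym (src-combine i j)) (trans eq (src-combine i k))))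

  share⇔adj : ∀ {i j} → i ≢ j → ShareVertex G (cycle i) (cycle j) ⇔ (adj H i j ≡ true)
  share⇔adj {i} {j} i≢j = mk⇔ share⇒adj adj⇒share
    where
    share⇒adj : ShareVertex G (cycle i) (cycle j) → adj H i j ≡ true
    share⇒adj (v , v∈i , v∈j) with ∈-cycle⁻ v∈i | ∈-cycle⁻ v∈j
    ... | k , refl | l , v≡ with stop-pair v≡
    ...   | inj₁ (i≡j , _)     = contradiction i≡j i≢j
    ...   | inj₂ (refl , refl) = stop-symmetric⇒adjacent i≢j v≡
    adj⇒share : adj H i j ≡ true → ShareVertex G (cycle i) (cycle j)
    adj⇒share i~j = stop i j , stop∈ i j , subst (_∈ _) (sym (stop-adjacent i~j)) (stop∈ j i)

  cycleModel : CycleModel H G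
  cycleModel = record
    { cycle          = cycle
    ; cycle-simple   = cycle-simple
    ; privateVertex  = λ i → stop i i
    ; private∈       = λ i → stop∈ i i
    ; private-unique = private-unique
    ; share⇔adj      = share⇔adj
    }
    where
    private-unique : ∀ {i j} → stop i i ∈ cycleVertices G (cycle j) → i ≡ j
    private-unique {i} stop∈j with ∈-cycle⁻ stop∈j
    ... | _ , eq with stop-pair eq
    ...   | inj₁ (i≡j , _) = i≡j
    ...   | inj₂ (_ , i≡j) = i≡j

proposition4 : (H : SimpleGraph) → ¬ Realizable H →
    ∃[ H' ] (Realizable H' × InducedSubgraph H H')
proposition4 H _ =
  hikeGraph G , (G , hikeGraph-iso G) ,
  inducedSubgraph-hikeGraph (hikeGraph G) cycleModel (hikeGraph-iso G)
  where open CycleGraph H
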